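{- Let $c,t\ge 1$ be integers, and let $K_0=c^{2c}(2c+2)^{c+1}t^c$. Let $G$ be a bipartite graph with parts $S$ and $Z$ such that every vertex in $S$ has degree at most $c$. Then there exist $Q\subseteq S$ and $X\subseteq Z$ such that $|Q|\ge |S|/K_0$, $|X|\le |Q|/t$, and for all distinct $u,v\in Q$, every common neighbor of $u$ and $v$ belongs to $X$.
   Context: Graphs are finite and simple. -}

module Defs where

open import Data.Nat using (ℕ; _+_; _*_; _^_; _≤_)
open import Data.Bool using (Bool; true)
open import Data.Fin using (Fin)
open import Data.Fin.Subset using (Subset; _∈_; ∣_∣)
open import Data.Vec using (tabulate)
open import Relation.Binary.PropositionalEquality using (_≡_; _≢_)

record BipartiteGraph (s z : ℕ) : Set where
  field
    adj : Fin s → Fin z → Bool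

open BipartiteGraph public

nbhd : ∀ {s z} → BipartiteGraph s z → Fin s → Subset z
nbhd G u = tabulate (λ w → adj G u w)

degS : ∀ {s z} → BipartiteGraph s z → Fin s → ℕ
degS G u = ∣ nbhd G u ∣

K₀ : ℕ → ℕ → ℕ
K₀ c t = c ^ (2 * c) * (2 * c + 2) ^ (c + 1) * t ^ c

module Submission where

-- Put L₀ = 0, L_{j+1} = R·(1 + c·L_j) with R = t·c·(c+1), and
-- cut the possible Z-degrees into the c+1 disjoint windows [1+L_j, 1+L_{j+1}).
-- A vertex u ∈ S has at most c neighbours, so it "hits" (has a neighbour
-- whose degree lies in) at most c of the c+1 windows; averaging gives a
-- window J hit by at most a c/(c+1) fraction of S, and the set A of vertices
-- not hitting it has |A| ≥ |S|/(c+1).  Let X be the Z-vertices of degree at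
-- least 1+L_{J+1}; double counting edges gives |X|·(1+L_{J+1}) ≤ c·|S|.
-- Call u, v ∈ A in conflict if they share a neighbour outside X.  Such a
-- neighbour of v ∈ A has degree ≤ L_J, so v has at most c·L_J conflicts and a
-- greedy maximal conflict-free Q ⊆ A has |A| ≤ |Q|·(1 + c·L_J).  The file first
-- develops finite counting (sums of indicators), disjoint windows, and the
-- greedy independent set; then the key construction for arbitrary c, R; and
-- finally the arithmetic 1 + c·L_J ≤ (1+cR)^c, which yields K₀ and |X| ≤ |Q|/t.

open import Defs
open import Data.Nat using (ℕ; _*_; _≤_)
open import Data.Bool using (true)
open import Data.Fin using (Fin)
open import Data.Fin.Subset using (Subset; _∈_; ∣_∣)
open import Data.Product using (Σ; _×_)
open import Relation.Binary.PropositionalEquality using (_≡_; _≢_)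

open import Data.Nat using (zero; suc; _+_; _^_; _<_; z≤n; s≤s; s≤s⁻¹; _≤?_; _≤ᵇ_; >-nonZero)
open import Data.Nat.Properties
open import Data.Nat.Tactic.RingSolver using (solve-∀)
open import Algebra.Properties.Semiring.Sum +-*-semiring
  using (sum; sum-syntax; sum-cong-≗; ∑-comm; ∑-distrib-+; *-distribˡ-sum; *-distribʳ-sum)
open import Data.Bool using (Bool; false; _∧_; _∨_; not)
import Data.Bool.Properties as Bool
open import Data.Fin using (zero; suc; toℕ)
import Data.Fin.Properties as Fin
open import Data.Vec using (tabulate)
open import Data.Vec.Properties using (lookup∘tabulate; lookup⇒[]=; []=⇒lookup)
open import Data.Vec.Functional using (_∷_)
open import Data.Product using (_,_; ∃-syntax; proj₁; proj₂)
open import Data.Sum using (_⊎_; inj₁; inj₂; map₁)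
open import Function using (_∘_; case_of_)
open import Relation.Nullary using (yes; no; does; contradiction)
open import Relation.Nullary.Reflects using (ofʸ; ofⁿ)
open import Relation.Nullary.Decidable using (dec-true; _×-dec_)
open import Relation.Binary.PropositionalEquality
  using (refl; sym; trans; cong; cong₂; subst; subst₂; module ≡-Reasoning)

𝟙 : Bool → ℕ
𝟙 true = 1
𝟙 false = 0

size : ∀ {n} → (Fin n → Bool) → ℕ
size {n} p = ∑[ i < n ] 𝟙 (p i)

sum-mono : ∀ {n} {f g : Fin n → ℕ} → (∀ i → f i ≤ g i) → sum f ≤ sum g
sum-mono {zero} f≤g = z≤n
sum-mono {suc n} f≤g = +-mono-≤ (f≤g zero) (sum-mono (f≤g ∘ suc))

sum-const : ∀ n k → ∑[ i < n ] k ≡ n * k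
sum-const zero k = refl
sum-const (suc n) k = cong (k +_) (sum-const n k)

sum-≤-* : ∀ {n} {f : Fin n → ℕ} k → (∀ i → f i ≤ k) → sum f ≤ n * k
sum-≤-* {n} k f≤k = subst (_ ≤_) (sum-const n k) (sum-mono f≤k)

term≤sum : ∀ {n} (f : Fin n → ℕ) i → f i ≤ sum f
term≤sum f zero = m≤m+n _ _
term≤sum f (suc i) = ≤-trans (term≤sum (f ∘ suc) i) (m≤n+m _ _)

sum≡0 : ∀ {n} (f : Fin n → ℕ) → sum f ≡ 0 → ∀ i → f i ≡ 0
sum≡0 f Σf≡0 i = n≤0⇒n≡0 (subst (f i ≤_) Σf≡0 (term≤sum f i))

𝟙≤1 : ∀ b → 𝟙 b ≤ 1
𝟙≤1 true = ≤-refl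
𝟙≤1 false = z≤n

𝟙-∨ : ∀ a b → 𝟙 (a ∨ b) ≤ 𝟙 a + 𝟙 b
𝟙-∨ true b = s≤s z≤n
𝟙-∨ false b = ≤-refl

∨-true : ∀ {a b} → a ≡ true ⊎ b ≡ true → a ∨ b ≡ true
∨-true {true} _ = refl
∨-true {false} (inj₂ b≡true) = b≡true

size-complement : ∀ {n} (p : Fin n → Bool) → size (not ∘ p) + size p ≡ n
size-complement {n} p = begin
  size (not ∘ p) + size p          ≡⟨ ∑-distrib-+ (𝟙 ∘ not ∘ p) (𝟙 ∘ p) ⟨
  ∑[ i < n ] (𝟙 (not (p i)) + 𝟙 (p i)) ≡⟨ sum-cong-≗ (λ i → split (p i)) ⟩
  ∑[ i < n ] 1                     ≡⟨ sum-const n 1 ⟩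
  n * 1                            ≡⟨ *-identityʳ n ⟩
  n                                ∎
  where
  open ≡-Reasoning
  split : ∀ b → 𝟙 (not b) + 𝟙 b ≡ 1
  split true = refl
  split false = refl

𝟙-*≡0 : ∀ {a b} → a ≡ true → 𝟙 a * 𝟙 b ≡ 0 → b ≡ false
𝟙-*≡0 {true} {false} _ _ = refl
𝟙-*≡0 {true} {true}  _ ()

-- `positive n` tests 1 ≤ n; applied to a count it decides existence.
positive : ℕ → Bool
positive n = 1 ≤ᵇ n

𝟙-positive≤ : ∀ n → 𝟙 (positive n) ≤ n
𝟙-positive≤ zero = z≤n
𝟙-positive≤ (suc n) = s≤s z≤n

positive-false : ∀ n → positive n ≡ false → n ≡ 0
positive-false zero _ = refl

sum-indicator-≟ : ∀ {n} (v : Fin n) → ∑[ u < n ] 𝟙 (does (u Fin.≟ v)) ≡ 1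
sum-indicator-≟ {suc n} zero = cong suc (trans (sum-const n 0) (*-zeroʳ n))
sum-indicator-≟ {suc n} (suc v) = sum-indicator-≟ v

∣tabulate∣ : ∀ {n} (p : Fin n → Bool) → ∣ tabulate p ∣ ≡ size p
∣tabulate∣ {zero} p = refl
∣tabulate∣ {suc n} p with p zero
... | true = cong suc (∣tabulate∣ (p ∘ suc))
... | false = ∣tabulate∣ (p ∘ suc)

∈-tabulate⁺ : ∀ {n} (p : Fin n → Bool) i → p i ≡ true → i ∈ tabulate p
∈-tabulate⁺ p i pi≡true = lookup⇒[]= i (tabulate p) (trans (lookup∘tabulate p i) pi≡true)

∈-tabulate⁻ : ∀ {n} (p : Fin n → Bool) i → i ∈ tabulate p → p i ≡ true
∈-tabulate⁻ p i i∈p = trans (sym (lookup∘tabulate p i)) ([]=⇒lookup i∈p)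

markov : ∀ {n} (g : Fin n → ℕ) b → b * size (λ w → b ≤ᵇ g w) ≤ sum g
markov g b = begin
  b * size (λ w → b ≤ᵇ g w)       ≡⟨ *-distribˡ-sum b (λ w → 𝟙 (b ≤ᵇ g w)) ⟩
  sum (λ w → b * 𝟙 (b ≤ᵇ g w))     ≤⟨ sum-mono term ⟩
  sum g                                  ∎
  where
  open ≤-Reasoning
  term : ∀ w → b * 𝟙 (b ≤ᵇ g w) ≤ g w
  term w with b ≤ᵇ g w | ≤ᵇ-reflects-≤ b (g w)
  ... | true  | ofʸ b≤gw = subst (_≤ g w) (sym (*-identityʳ b)) b≤gw
  ... | false | _        = subst (_≤ g w) (sym (*-zeroʳ b)) z≤n

minimiser : ∀ {n} (f : Fin (suc n) → ℕ) → ∃[ j ] (∀ i → f j ≤ f i)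
minimiser {zero} f = zero , λ { zero → ≤-refl }
minimiser {suc n} f with minimiser (f ∘ suc)
... | j , fj≤ with f zero ≤? f (suc j)
...   | yes f0≤fj = zero , λ { zero → ≤-refl ; (suc i) → ≤-trans f0≤fj (fj≤ i) }
...   | no f0≰fj = suc j , λ { zero → <⇒≤ (≰⇒> f0≰fj) ; (suc i) → fj≤ i }

below-average : ∀ {n} (f : Fin (suc n) → ℕ) → ∃[ j ] suc n * f j ≤ sum f
below-average {n} f with minimiser f
... | j , fj≤ = j , subst (_≤ sum f) (sum-const (suc n) (f j)) (sum-mono fj≤)

Monotone : (ℕ → ℕ) → Set
Monotone B = ∀ k → B k ≤ B (suc k)

interval : (ℕ → ℕ) → ℕ → ℕ → Bool
interval B j x = (B j ≤ᵇ x) ∧ not (B (suc j) ≤ᵇ x)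

-- One telescoping step: "x lies in window 0" and "x ≥ B 1" are exclusive,
-- and each implies x ≥ B 0.
interval-step : ∀ (B : ℕ → ℕ) → B 0 ≤ B 1 → ∀ x →
  𝟙 (interval B 0 x) + 𝟙 (B 1 ≤ᵇ x) ≤ 𝟙 (B 0 ≤ᵇ x)
interval-step B B₀≤B₁ x with B 0 ≤ᵇ x | ≤ᵇ-reflects-≤ (B 0) x | B 1 ≤ᵇ x | ≤ᵇ-reflects-≤ (B 1) x
... | true  | _        | true  | _        = ≤-refl
... | true  | _        | false | _        = ≤-refl
... | false | ofⁿ B₀≰x | true  | ofʸ B₁≤x = contradiction (≤-trans B₀≤B₁ B₁≤x) B₀≰x
... | false | _        | false | _        = ≤-refl

below-interval : ∀ (B : ℕ → ℕ) j x → interval B j x ≡ false → (B (suc j) ≤ᵇ x) ≡ false → x < B j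
below-interval B j x with B j ≤ᵇ x | ≤ᵇ-reflects-≤ (B j) x | B (suc j) ≤ᵇ x
... | false | ofⁿ Bⱼ≰x | _     = λ _ _ → ≰⇒> Bⱼ≰x
... | true  | _        | false = λ ()
... | true  | _        | true  = λ _ ()

-- Telescoping over the first n windows: the windows and the tail [B n, ∞)
-- are pairwise disjoint subsets of [B 0, ∞).
intervals-telescope : ∀ (B : ℕ → ℕ) → Monotone B → ∀ n x →
  ∑[ j < n ] 𝟙 (interval B (toℕ j) x) + 𝟙 (B n ≤ᵇ x) ≤ 𝟙 (B 0 ≤ᵇ x)
intervals-telescope B mono zero x = ≤-refl
intervals-telescope B mono (suc n) x = begin
  first + rest + 𝟙 (B (suc n) ≤ᵇ x)   ≡⟨ +-assoc first rest _ ⟩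
  first + (rest + 𝟙 (B (suc n) ≤ᵇ x)) ≤⟨ +-monoʳ-≤ first (intervals-telescope (B ∘ suc) (mono ∘ suc) n x) ⟩
  first + 𝟙 (B 1 ≤ᵇ x)                ≤⟨ interval-step B (mono 0) x ⟩
  𝟙 (B 0 ≤ᵇ x)                        ∎
  where
  open ≤-Reasoning
  first : ℕ
  first = 𝟙 (interval B 0 x)
  rest : ℕ
  rest = ∑[ j < n ] 𝟙 (interval (B ∘ suc) (toℕ j) x)

intervals-disjoint : ∀ (B : ℕ → ℕ) → Monotone B → ∀ n x → ∑[ j < n ] 𝟙 (interval B (toℕ j) x) ≤ 1
intervals-disjoint B mono n x =
  ≤-trans (m≤m+n _ _) (≤-trans (intervals-telescope B mono n x) (𝟙≤1 (B 0 ≤ᵇ x)))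

hits : ∀ {z} → (Fin z → Bool) → (Fin z → ℕ) → (ℕ → ℕ) → ℕ → Bool
hits {z} N g B j = positive (∑[ w < z ] (𝟙 (N w) * 𝟙 (interval B j (g w))))

-- A set N meets at most |N| windows, since each element lies in at most one.
few-hits : ∀ {z} (N : Fin z → Bool) (g : Fin z → ℕ) (B : ℕ → ℕ) → Monotone B → ∀ n →
  ∑[ j < n ] 𝟙 (hits N g B (toℕ j)) ≤ size N
few-hits {z} N g B mono n = begin
  ∑[ j < n ] 𝟙 (hits N g B (toℕ j))                  ≤⟨ sum-mono (λ j → 𝟙-positive≤ (meets j)) ⟩
  ∑[ j < n ] ∑[ w < z ] (𝟙 (N w) * in? (toℕ j) w)   ≡⟨ ∑-comm (λ (j : Fin n) w → 𝟙 (N w) * in? (toℕ j) w) ⟩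
  ∑[ w < z ] ∑[ j < n ] (𝟙 (N w) * in? (toℕ j) w)   ≡⟨ sum-cong-≗ (λ w → *-distribˡ-sum (𝟙 (N w)) (λ (j : Fin n) → in? (toℕ j) w)) ⟨
  ∑[ w < z ] (𝟙 (N w) * ∑[ j < n ] in? (toℕ j) w)   ≤⟨ sum-mono (λ w → *-monoʳ-≤ (𝟙 (N w)) (intervals-disjoint B mono n (g w))) ⟩
  ∑[ w < z ] (𝟙 (N w) * 1)                          ≡⟨ sum-cong-≗ (λ w → *-identityʳ (𝟙 (N w))) ⟩
  size N                                           ∎
  where
  open ≤-Reasoning
  in? : ℕ → Fin z → ℕ
  in? j w = 𝟙 (interval B j (g w))
  meets : Fin n → ℕ
  meets j = ∑[ w < z ] (𝟙 (N w) * in? (toℕ j) w)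

Symmetric : ∀ {n} → (Fin n → Fin n → Bool) → Set
Symmetric {n} conflict = ∀ (u v : Fin n) → conflict u v ≡ conflict v u

record IndependentDominating {n} (A : Fin n → Bool) (conflict : Fin n → Fin n → Bool) : Set where
  field
    I           : Fin n → Bool
    I⊆A         : ∀ u → I u ≡ true → A u ≡ true
    independent : ∀ u v → I u ≡ true → I v ≡ true → u ≢ v → conflict u v ≡ false
    dominating  : ∀ u → A u ≡ true → ∃[ v ] (I v ≡ true × (u ≡ v ⊎ conflict v u ≡ true))

open IndependentDominating

extend : ∀ {n} {A : Fin (suc n) → Bool} {conflict : Fin (suc n) → Fin (suc n) → Bool} →
  Symmetric conflict →
  (rest : IndependentDominating (A ∘ suc) (λ u v → conflict (suc u) (suc v))) →
  (b : Bool) →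
  (b ≡ true → A zero ≡ true) →
  (b ≡ true → ∀ v → I rest v ≡ true → conflict (suc v) zero ≡ false) →
  (A zero ≡ true → b ≡ true ⊎ ∃[ v ] (I rest v ≡ true × conflict (suc v) zero ≡ true)) →
  IndependentDominating A conflict
extend {A = A} {conflict} conflict-sym rest b b⇒A₀ b⇒free zero-covered = record
  { I = b ∷ I rest ; I⊆A = I⊆A′ ; independent = independent′ ; dominating = dominating′ }
  where
  I⊆A′ : ∀ u → (b ∷ I rest) u ≡ true → A u ≡ true
  I⊆A′ zero    = b⇒A₀
  I⊆A′ (suc u) = I⊆A rest u
  independent′ : ∀ u v → (b ∷ I rest) u ≡ true → (b ∷ I rest) v ≡ true → u ≢ v → conflict u v ≡ false
  independent′ zero    zero    _  _  u≢v = contradiction refl u≢v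
  independent′ zero    (suc v) b≡true Iv _ = trans (conflict-sym zero (suc v)) (b⇒free b≡true v Iv)
  independent′ (suc u) zero    Iu b≡true _ = b⇒free b≡true u Iu
  independent′ (suc u) (suc v) Iu Iv u≢v = independent rest u v Iu Iv (u≢v ∘ cong suc)
  dominating′ : ∀ u → A u ≡ true → ∃[ v ] ((b ∷ I rest) v ≡ true × (u ≡ v ⊎ conflict v u ≡ true))
  dominating′ zero A₀ with zero-covered A₀
  ... | inj₁ b≡true           = zero , b≡true , inj₁ refl
  ... | inj₂ (v , Iv , clash) = suc v , Iv , inj₂ clash
  dominating′ (suc u) Au with dominating rest u Au
  ... | v , Iv , inj₁ u≡v   = suc v , Iv , inj₁ (cong suc u≡v)
  ... | v , Iv , inj₂ clash = suc v , Iv , inj₂ clash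

-- Every A has an independent dominating subset, built greedily: vertex 0 is
-- added exactly when it is in A and conflicts with none of the chosen set.
greedy : ∀ {n} (A : Fin n → Bool) (conflict : Fin n → Fin n → Bool) →
  Symmetric conflict → IndependentDominating A conflict
greedy {zero} A conflict _ = record { I = λ () ; I⊆A = λ () ; independent = λ () ; dominating = λ () }
greedy {suc n} A conflict conflict-sym
  with greedy (A ∘ suc) (λ u v → conflict (suc u) (suc v)) (λ u v → conflict-sym (suc u) (suc v))
... | rest with A zero in A₀≡ | Fin.any? (λ v → (I rest v Bool.≟ true) ×-dec (conflict (suc v) zero Bool.≟ true))
...   | true  | no noClash = extend conflict-sym rest true (λ _ → A₀≡)
                               (λ _ v Iv → Bool.¬-not (λ clash → noClash (v , Iv , clash))) (λ _ → inj₁ refl)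
...   | true  | yes (v , Iv , clash) = extend conflict-sym rest false (λ ()) (λ ()) (λ _ → inj₂ (v , Iv , clash))
...   | false | _ = extend conflict-sym rest false (λ ()) (λ ()) (λ A₀ → contradiction (trans (sym A₀) A₀≡) λ ())

-- Closed conflict neighbourhoods of I cover A, so if every vertex of A has at
-- most d conflicts then |A| ≤ |I| · (1 + d).
independent-bound : ∀ {n} {A : Fin n → Bool} {conflict : Fin n → Fin n → Bool}
  (mis : IndependentDominating A conflict) (d : ℕ) →
  (∀ v → A v ≡ true → size (conflict v) ≤ d) → size A ≤ size (I mis) * suc d
independent-bound {n} {A} {conflict} mis d few = begin
  size A                                          ≤⟨ sum-mono covered ⟩
  ∑[ u < n ] ∑[ v < n ] (𝟙 (I mis v) * closed v u)  ≡⟨ ∑-comm (λ u v → 𝟙 (I mis v) * closed v u) ⟩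
  ∑[ v < n ] ∑[ u < n ] (𝟙 (I mis v) * closed v u)  ≡⟨ sum-cong-≗ (λ v → *-distribˡ-sum (𝟙 (I mis v)) (closed v)) ⟨
  ∑[ v < n ] (𝟙 (I mis v) * ∑[ u < n ] closed v u)  ≤⟨ sum-mono closed-few ⟩
  ∑[ v < n ] (𝟙 (I mis v) * suc d)                  ≡⟨ *-distribʳ-sum (suc d) (𝟙 ∘ I mis) ⟨
  size (I mis) * suc d                              ∎
  where
  open ≤-Reasoning
  closed : Fin n → Fin n → ℕ
  closed v u = 𝟙 (does (u Fin.≟ v) ∨ conflict v u)
  covered : ∀ u → 𝟙 (A u) ≤ ∑[ v < n ] (𝟙 (I mis v) * closed v u)
  covered u with A u in Au
  ... | false = z≤n
  ... | true with dominating mis u Au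
  ...   | v , Iv , u≡v⊎clash = subst (_≤ ∑[ v < n ] (𝟙 (I mis v) * closed v u)) one
                                   (term≤sum (λ v → 𝟙 (I mis v) * closed v u) v)
    where
    one : 𝟙 (I mis v) * closed v u ≡ 1
    one = cong₂ (λ x y → 𝟙 x * 𝟙 y) Iv (∨-true (map₁ (dec-true (u Fin.≟ v)) u≡v⊎clash))
  closed-few : ∀ v → 𝟙 (I mis v) * ∑[ u < n ] closed v u ≤ 𝟙 (I mis v) * suc d
  closed-few v with I mis v in Iv
  ... | false = z≤n
  ... | true  = *-monoʳ-≤ 1 (begin
    ∑[ u < n ] closed v u                                 ≤⟨ sum-mono (λ u → 𝟙-∨ (does (u Fin.≟ v)) (conflict v u)) ⟩
    ∑[ u < n ] (𝟙 (does (u Fin.≟ v)) + 𝟙 (conflict v u))  ≡⟨ ∑-distrib-+ (λ u → 𝟙 (does (u Fin.≟ v))) (𝟙 ∘ conflict v) ⟩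
    ∑[ u < n ] 𝟙 (does (u Fin.≟ v)) + size (conflict v)   ≡⟨ cong (_+ size (conflict v)) (sum-indicator-≟ v) ⟩
    suc (size (conflict v))                               ≤⟨ s≤s (few v (I⊆A mis v Iv)) ⟩
    suc d                                                 ∎)

-- The degree thresholds: L 0 = 0 and L (j+1) = R · D j, where D j = 1 + c · L j
-- bounds the closed conflict degree when window j is avoided.
L : ℕ → ℕ → ℕ → ℕ
L c R zero    = 0
L c R (suc j) = R * suc (c * L c R j)

D : ℕ → ℕ → ℕ → ℕ
D c R j = suc (c * L c R j)

L-mono : ∀ c R → Monotone (L c R)
L-mono c R zero    = z≤n
L-mono c R (suc j) = *-monoʳ-≤ R (s≤s (*-monoʳ-≤ c (L-mono c R j)))

-- Since D (j+1) = 1 + cR · D j, the bounds grow at most like (1 + cR)^j.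
D-growth : ∀ c R j → D c R j ≤ suc (c * R) ^ j
D-growth c R zero    = ≤-reflexive (cong suc (*-zeroʳ c))
D-growth c R (suc j) = begin
  suc (c * (R * D c R j))     ≤⟨ +-mono-≤ (s≤s z≤n) (≤-reflexive (sym (*-assoc c R (D c R j)))) ⟩
  suc (c * R) * D c R j       ≤⟨ *-monoʳ-≤ (suc (c * R)) (D-growth c R j) ⟩
  suc (c * R) ^ suc j         ∎
  where open ≤-Reasoning

complement-large : ∀ c a b s → a + b ≡ s → suc c * b ≤ s * c → s ≤ suc c * a
complement-large c a b s a+b≡s few = +-cancelʳ-≤ (c * s) s (suc c * a) (begin
  suc c * s             ≡⟨ cong (suc c *_) a+b≡s ⟨
  suc c * (a + b)       ≡⟨ *-distribˡ-+ (suc c) a b ⟩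
  suc c * a + suc c * b ≤⟨ +-monoʳ-≤ (suc c * a) few ⟩
  suc c * a + s * c     ≡⟨ cong (suc c * a +_) (*-comm s c) ⟩
  suc c * a + c * s     ∎)
  where open ≤-Reasoning

CommonNeighboursIn : ∀ {s z} → BipartiteGraph s z → Subset s → Subset z → Set
CommonNeighboursIn {s} {z} G Q X = (u v : Fin s) → u ∈ Q → v ∈ Q → u ≢ v →
  (w : Fin z) → adj G u w ≡ true → adj G v w ≡ true → w ∈ X

module KeyConstruction {s z} (G : BipartiteGraph s z) (c R : ℕ) (deg≤c : ∀ u → degS G u ≤ c) where

  B : ℕ → ℕ
  B j = suc (L c R j)

  B-mono : Monotone B
  B-mono j = s≤s (L-mono c R j)

  degZ : Fin z → ℕ
  degZ w = ∑[ u < s ] 𝟙 (adj G u w)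

  size-nbhd≤c : ∀ u → size (adj G u) ≤ c
  size-nbhd≤c u = subst (_≤ c) (∣tabulate∣ (adj G u)) (deg≤c u)

  -- Double counting edges: the Z-degrees sum to the S-degrees, at most c · |S|.
  edges≤ : sum degZ ≤ s * c
  edges≤ = ≤-trans (≤-reflexive (∑-comm (λ w u → 𝟙 (adj G u w)))) (sum-≤-* c size-nbhd≤c)

  hitsAt : Fin s → ℕ → Bool
  hitsAt u = hits (adj G u) degZ B

  hitters : Fin (suc c) → ℕ
  hitters j = size (λ u → hitsAt u (toℕ j))

  -- Each vertex hits at most c windows, so there are at most c · |S| hits.
  total-hits : sum hitters ≤ s * c
  total-hits = ≤-trans (≤-reflexive (∑-comm (λ (j : Fin (suc c)) u → 𝟙 (hitsAt u (toℕ j)))))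
    (sum-≤-* {s} c (λ u → ≤-trans (few-hits (adj G u) degZ B B-mono (suc c)) (size-nbhd≤c u)))

  quiet : ∃[ j ] suc c * hitters j ≤ sum hitters
  quiet = below-average hitters

  J : ℕ
  J = toℕ (proj₁ quiet)

  J≤c : J ≤ c
  J≤c = s≤s⁻¹ (Fin.toℕ<n (proj₁ quiet))

  A : Fin s → Bool
  A u = not (hitsAt u J)

  A-large : s ≤ suc c * size A
  A-large = complement-large c (size A) (hitters (proj₁ quiet)) s
    (size-complement (λ u → hitsAt u J)) (≤-trans (proj₂ quiet) total-hits)

  -- The exceptional vertices: degree beyond window J.  Markov bounds their
  -- number by c · |S| / B (J+1).
  X : Fin z → Bool
  X w = B (suc J) ≤ᵇ degZ w

  X-small : B (suc J) * size X ≤ s * c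
  X-small = ≤-trans (markov degZ (B (suc J))) edges≤

  shared : Fin s → Fin s → Fin z → ℕ
  shared u v w = 𝟙 (adj G u w) * 𝟙 (not (X w)) * 𝟙 (adj G v w)

  conflict : Fin s → Fin s → Bool
  conflict u v = positive (∑[ w < z ] shared u v w)

  conflict-sym : Symmetric conflict
  conflict-sym u v = cong positive (sum-cong-≗ (λ w → swap (𝟙 (adj G u w)) (𝟙 (not (X w))) (𝟙 (adj G v w))))
    where
    swap : ∀ p q r → p * q * r ≡ r * q * p
    swap = solve-∀

  -- A neighbour outside X of a vertex of A misses window J and lies below its
  -- upper end, so its degree is at most L J.
  low-degree : ∀ v w → A v ≡ true → adj G v w ≡ true → X w ≡ false → degZ w ≤ L c R J
  low-degree v w Av vw Xw = s≤s⁻¹ (below-interval B J (degZ w) outside Xw)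
    where
    quietAt-v : hitsAt v J ≡ false
    quietAt-v = Bool.not-injective {y = false} Av
    outside : interval B J (degZ w) ≡ false
    outside = 𝟙-*≡0 vw (sum≡0 _ (positive-false _ quietAt-v) w)

  -- So v ∈ A conflicts with at most (its ≤ c neighbours outside X) × (their
  -- degrees ≤ L J) vertices.
  few-conflicts : ∀ v → A v ≡ true → size (conflict v) ≤ c * L c R J
  few-conflicts v Av = begin
    size (conflict v)                                          ≤⟨ sum-mono (λ u → 𝟙-positive≤ (∑[ w < z ] shared v u w)) ⟩
    ∑[ u < s ] ∑[ w < z ] shared v u w                         ≡⟨ ∑-comm (shared v) ⟩
    ∑[ w < z ] ∑[ u < s ] shared v u w                         ≡⟨ sum-cong-≗ (λ w → *-distribˡ-sum (outsideNbr w) (λ u → 𝟙 (adj G u w))) ⟨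
    ∑[ w < z ] (outsideNbr w * degZ w)                         ≤⟨ sum-mono bounded ⟩
    ∑[ w < z ] (𝟙 (adj G v w) * L c R J)                       ≡⟨ *-distribʳ-sum (L c R J) (𝟙 ∘ adj G v) ⟨
    size (adj G v) * L c R J                                   ≤⟨ *-monoˡ-≤ (L c R J) (size-nbhd≤c v) ⟩
    c * L c R J                                                ∎
    where
    open ≤-Reasoning
    outsideNbr : Fin z → ℕ
    outsideNbr w = 𝟙 (adj G v w) * 𝟙 (not (X w))
    bounded : ∀ w → outsideNbr w * degZ w ≤ 𝟙 (adj G v w) * L c R J
    bounded w with adj G v w in vw | X w in Xw
    ... | false | _     = z≤n
    ... | true  | true  = z≤n
    ... | true  | false = +-monoˡ-≤ 0 (low-degree v w Av vw Xw)

  mis : IndependentDominating A conflict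
  mis = greedy A conflict conflict-sym

  Q : Fin s → Bool
  Q = I mis

  Q-large : s ≤ suc c * D c R J * size Q
  Q-large = begin
    s                                 ≤⟨ A-large ⟩
    suc c * size A                    ≤⟨ *-monoʳ-≤ (suc c) (independent-bound mis (c * L c R J) few-conflicts) ⟩
    suc c * (size Q * D c R J)        ≡⟨ cong (suc c *_) (*-comm (size Q) (D c R J)) ⟩
    suc c * (D c R J * size Q)        ≡⟨ *-assoc (suc c) (D c R J) (size Q) ⟨
    suc c * D c R J * size Q          ∎
    where open ≤-Reasoning

  -- Distinct members of Q do not conflict: their common neighbours lie in X.
  common-in-X : ∀ u v → Q u ≡ true → Q v ≡ true → u ≢ v →
    ∀ w → adj G u w ≡ true → adj G v w ≡ true → X w ≡ true
  common-in-X u v Qu Qv u≢v w uw vw with X w | sum≡0 (shared u v) (positive-false _ (independent mis u v Qu Qv u≢v)) w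
  ... | true  | _      = refl
  ... | false | none = contradiction (subst₂ (λ p q → 𝟙 p * 1 * 𝟙 q ≡ 0) uw vw none) λ ()

sparse-common-neighbours : ∀ {s z} (G : BipartiteGraph s z) (c R : ℕ) → (∀ u → degS G u ≤ c) →
  ∃[ J ] (J ≤ c × Σ (Subset s) λ Q → Σ (Subset z) λ X →
    (s ≤ suc c * D c R J * ∣ Q ∣) × (suc (R * D c R J) * ∣ X ∣ ≤ s * c) × CommonNeighboursIn G Q X)
sparse-common-neighbours {s} {z} G c R deg≤c = J , J≤c , tabulate Q , tabulate X ,
  subst (λ q → s ≤ suc c * D c R J * q) (sym (∣tabulate∣ Q)) Q-large ,
  subst (λ x → suc (R * D c R J) * x ≤ s * c) (sym (∣tabulate∣ X)) X-small ,
  λ u v u∈Q v∈Q u≢v w uw vw → ∈-tabulate⁺ X w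
    (common-in-X u v (∈-tabulate⁻ Q u u∈Q) (∈-tabulate⁻ Q v v∈Q) u≢v w uw vw)
  where open KeyConstruction G c R deg≤c

^-distribʳ-* : ∀ m n k → (m * n) ^ k ≡ m ^ k * n ^ k
^-distribʳ-* m n zero    = refl
^-distribʳ-* m n (suc k) = trans (cong (m * n *_) (^-distribʳ-* m n k)) (interchange m n (m ^ k) (n ^ k))
  where
  interchange : ∀ a b x y → a * b * (x * y) ≡ a * x * (b * y)
  interchange = solve-∀

-- With R = t·c·(c+1): (c+1)(1 + cR)^c ≤ K₀, using 1 + cR ≤ 2cR = c²(2c+2)t.
K₀-bound : ∀ c t → 1 ≤ c → 1 ≤ t → suc c * suc (c * (t * c * suc c)) ^ c ≤ K₀ c t
K₀-bound c t c≥1 t≥1 = begin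
  suc c * suc (c * R) ^ c                      ≤⟨ *-mono-≤ c+1≤b (^-monoˡ-≤ c base-bound) ⟩
  b * (c ^ 2 * b * t) ^ c                      ≡⟨ cong (b *_) (trans (^-distribʳ-* (c ^ 2 * b) t c) (cong (_* t ^ c) (^-distribʳ-* (c ^ 2) b c))) ⟩
  b * ((c ^ 2) ^ c * b ^ c * t ^ c)            ≡⟨ cong (λ p → b * (p * b ^ c * t ^ c)) (^-*-assoc c 2 c) ⟩
  b * (c ^ (2 * c) * b ^ c * t ^ c)            ≡⟨ regroup (c ^ (2 * c)) (b ^ c) b (t ^ c) ⟩
  c ^ (2 * c) * (b ^ c * b ^ 1) * t ^ c        ≡⟨ cong (λ p → c ^ (2 * c) * p * t ^ c) (^-distribˡ-+-* b c 1) ⟨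
  K₀ c t                                       ∎
  where
  open ≤-Reasoning
  R : ℕ
  R = t * c * suc c
  b : ℕ
  b = 2 * c + 2
  c+1≤b : suc c ≤ b
  c+1≤b = ≤-trans (m≤m+n (suc c) (suc c)) (≤-reflexive (twice c))
    where
    twice : ∀ x → (1 + x) + (1 + x) ≡ 2 * x + 2
    twice = solve-∀
  cR≥1 : 1 ≤ c * R
  cR≥1 = *-mono-≤ c≥1 (*-mono-≤ (*-mono-≤ t≥1 c≥1) (s≤s z≤n))
  base-bound : suc (c * R) ≤ c ^ 2 * b * t
  base-bound = ≤-trans (+-monoˡ-≤ (c * R) cR≥1) (≤-reflexive (double c t))
    where
    double : ∀ x y → x * (y * x * (1 + x)) + x * (y * x * (1 + x)) ≡ x * (x * 1) * (2 * x + 2) * y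
    double = solve-∀
  regroup : ∀ x y z w → z * (x * y * w) ≡ x * (y * (z * 1)) * w
  regroup = solve-∀

-- With R = t·c·(c+1) the two bounds of the key lemma give t · |X| ≤ |Q|,
-- after cancelling the common factor c(c+1)·D.
exceptional-small : ∀ c t d x q s → 1 ≤ c →
  suc (t * c * suc c * suc d) * x ≤ s * c → s ≤ suc c * suc d * q → t * x ≤ q
exceptional-small c t d x q s c≥1 X-small Q-large =
  *-cancelˡ-≤ M {{>-nonZero (*-mono-≤ (*-mono-≤ c≥1 (s≤s z≤n)) (s≤s z≤n))}} (begin
    M * (t * x)                   ≡⟨ reorder₁ c t d x ⟩
    t * c * suc c * suc d * x     ≤⟨ m≤n+m _ x ⟩
    suc (t * c * suc c * suc d) * x ≤⟨ X-small ⟩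
    s * c                         ≤⟨ *-monoˡ-≤ c Q-large ⟩
    suc c * suc d * q * c         ≡⟨ reorder₂ c d q ⟩
    M * q                         ∎)
  where
  open ≤-Reasoning
  M : ℕ
  M = c * suc c * suc d
  reorder₁ : ∀ c t d x → c * (1 + c) * (1 + d) * (t * x) ≡ t * c * (1 + c) * (1 + d) * x
  reorder₁ = solve-∀
  reorder₂ : ∀ c d q → (1 + c) * (1 + d) * q * c ≡ c * (1 + c) * (1 + d) * q
  reorder₂ = solve-∀

scale≤K₀ : ∀ c t J → 1 ≤ c → 1 ≤ t → J ≤ c → suc c * D c (t * c * suc c) J ≤ K₀ c t
scale≤K₀ c t J c≥1 t≥1 J≤c = begin
  suc c * D c R J          ≤⟨ *-monoʳ-≤ (suc c) (D-growth c R J) ⟩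
  suc c * suc (c * R) ^ J  ≤⟨ *-monoʳ-≤ (suc c) (^-monoʳ-≤ (suc (c * R)) J≤c) ⟩
  suc c * suc (c * R) ^ c  ≤⟨ K₀-bound c t c≥1 t≥1 ⟩
  K₀ c t                   ∎
  where
  open ≤-Reasoning
  R : ℕ
  R = t * c * suc c

lemma4p1 : (c t : ℕ) → 1 ≤ c → 1 ≤ t →
    (s z : ℕ) (G : BipartiteGraph s z) →
    ((u : Fin s) → degS G u ≤ c) →
    Σ (Subset s) λ Q → Σ (Subset z) λ X →
      (s ≤ K₀ c t * ∣ Q ∣)
      × (t * ∣ X ∣ ≤ ∣ Q ∣)
      × ((u v : Fin s) → u ∈ Q → v ∈ Q → u ≢ v →
           (w : Fin z) → adj G u w ≡ true → adj G v w ≡ true → w ∈ X)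
lemma4p1 c t c≥1 t≥1 s z G deg≤c = case sparse-common-neighbours G c (t * c * suc c) deg≤c of λ where
  (J , J≤c , Q , X , Q-large , X-small , common) →
    Q , X ,
    ≤-trans Q-large (*-monoˡ-≤ ∣ Q ∣ (scale≤K₀ c t J c≥1 t≥1 J≤c)) ,
    exceptional-small c t (c * L c (t * c * suc c) J) ∣ X ∣ ∣ Q ∣ s c≥1 X-small Q-large ,
    common
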